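{- Let $k,q,m$ be integers with $1\le k<q$ and $m\ge 1$. Then every clique in $H_{k,q;m}$ is contained in a clique of the form $C_f$ for some function $f:\binom{[q]}{k}\to[m]$, and every maximal clique of $H_{k,q;m}$ has size $q$. Furthermore, each clique of size $k+1$ in $H_{k,q;m}$ is contained in a unique clique of the form $C_f$, while every clique of size $k$ is contained in $m$ distinct cliques of the form $C_f$.
   Context: $[n]=\{1,\ldots,n\}$ and for a set $S$, $\binom{S}{k}$ denotes the family of $k$-element subsets of $S$. For integers $1\le k<q$, $m\ge1$ and $i\in[q]$, let $\mathcal{F}_i$ be the set of all functions $f:\binom{[q]\setminus\{i\}}{k}\to[m]$. The graph $H_{k,q;m}$ has vertex set the disjoint union $\bigcup_{i=1}^q\mathcal{F}_i$, and for $f\in\mathcal{F}_i$, $g\in\mathcal{F}_j$, $f$ and $g$ are adjacent if and only if $i\ne j$ and $f$ and $g$ agree on $\binom{[q]\setminus\{i,j\}}{k}$. For a function $f:\binom{[q]}{k}\to[m]$, $C_f$ denotes the set of the $q$ restrictions of $f$ to $\binom{[q]\setminus\{i\}}{k}$, $1\le i\le q$ (the restriction to $\binom{[q]\setminus\{i\}}{k}$ being regarded as a vertex in $\mathcal{F}_i$); $C_f$ is a clique of size $q$. -}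

module Defs where

open import Data.Nat using (ℕ)
open import Data.Fin using (Fin)
open import Data.Fin.Subset using (Subset; ∣_∣; _∉_)
open import Data.Product using (Σ; _×_)
open import Data.List using (List)
open import Data.List.Relation.Unary.All using (All)
open import Data.List.Relation.Unary.Any using (Any)
open import Data.List.Relation.Unary.AllPairs using (AllPairs)
open import Relation.Binary.PropositionalEquality using (_≡_; _≢_)

-- k-element subsets of [q] are represented as S : Subset q together with a
-- (proof-irrelevant) proof of ∣ S ∣ ≡ k.

Colouring : (k q m : ℕ) → Set
Colouring k q m = (S : Subset q) → .(∣ S ∣ ≡ k) → Fin m

-- An element of F_i : a function binom([q] \ {i}, k) → [m]
Part : (k q m : ℕ) → Fin q → Set
Part k q m i = (S : Subset q) → .(∣ S ∣ ≡ k) → .(i ∉ S) → Fin m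

-- Vertices of H_{k,q;m}: the disjoint union of the F_i
record Vertex (k q m : ℕ) : Set where
  constructor vtx
  field
    part : Fin q
    fun  : Part k q m part
open Vertex public

module _ {k q m : ℕ} where

  VEq : Vertex k q m → Vertex k q m → Set
  VEq v w = part v ≡ part w ×
    (∀ (S : Subset q) .(p : ∣ S ∣ ≡ k) .(a : part v ∉ S) .(b : part w ∉ S) →
       fun v S p a ≡ fun w S p b)

  Member : Vertex k q m → List (Vertex k q m) → Set
  Member v ys = Any (VEq v) ys

  Adjacent : Vertex k q m → Vertex k q m → Set
  Adjacent v w = part v ≢ part w ×
    (∀ (S : Subset q) .(p : ∣ S ∣ ≡ k) .(a : part v ∉ S) .(b : part w ∉ S) →
       fun v S p a ≡ fun w S p b)

  -- A clique, represented by a list of its vertices; the size is the length.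
  -- Pairwise adjacency of entries at distinct positions also forces the
  -- entries to be pairwise distinct (adjacent vertices lie in different parts).
  IsClique : List (Vertex k q m) → Set
  IsClique xs = AllPairs Adjacent xs

  IsMaximalClique : List (Vertex k q m) → Set
  IsMaximalClique xs = IsClique xs ×
    (∀ (ys : List (Vertex k q m)) → IsClique ys →
       All (λ v → Member v ys) xs → All (λ w → Member w xs) ys)

  InC : Colouring k q m → Vertex k q m → Set
  InC f v = ∀ (S : Subset q) .(p : ∣ S ∣ ≡ k) .(a : part v ∉ S) → fun v S p a ≡ f S p

  ContainedInC : List (Vertex k q m) → Colouring k q m → Set
  ContainedInC xs f = All (InC f) xs

  SameC : Colouring k q m → Colouring k q m → Set
  SameC f g = ∀ (i : Fin q) (S : Subset q) .(p : ∣ S ∣ ≡ k) → i ∉ S → f S p ≡ g S p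

module Submission where

-- Given a clique xs and a default colour d, the colouring
-- extend d xs assigns to a k-set S the value of the first vertex of xs whose
-- part avoids S (all such vertices agree, by adjacency), and d if every part
-- of xs lies in S.  Then xs ⊆ C_{extend d xs}, and any g with xs ⊆ C_g agrees
-- with extend d xs except on k-sets S containing every part of xs.  Since the
-- vertices of a clique lie in distinct parts, such an S exists only if
-- length xs ≤ k, and for length xs ≡ k it is the set P of parts of xs itself.
--  * every clique lies in C_{extend d xs};
--  * a maximal clique contains the clique C_{extend d xs}, hence meets all q parts;
--  * for k+1 vertices there is no such S, so the extension is unique;
--  * for k vertices the extensions are exactly extend j xs, j ∈ [m], told apart
--    by their value on P, which some part i ∉ P sees because k < q.

open import Defs
open import Data.Nat using (ℕ; zero; suc; _≤_; _<_)
open import Data.Nat.Properties using (≤-reflexive; ≤-trans; ≤-antisym; ≤-pred; <-irrefl; <⇒≱; _≟_)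
open import Data.Fin using (Fin; zero; suc)
open import Data.Fin.Properties using (¬∀⟶∃¬)
open import Data.Fin.Subset
open import Data.Fin.Subset.Properties
open import Data.Product using (Σ; ∃; _×_; _,_; proj₁; proj₂)
open import Data.Sum using (_⊎_; inj₁; inj₂)
open import Data.Vec using ([]; _∷_; here; there)
open import Data.List using (List; []; _∷_; length; map; tabulate; foldr)
open import Data.List.Properties using (length-map)
open import Data.List.Membership.Propositional using () renaming (_∈_ to _∈ˡ_)
open import Data.List.Relation.Unary.All as All using (All; []; _∷_)
import Data.List.Relation.Unary.All.Properties as AllP
open import Data.List.Relation.Unary.Any as Any using (here; there)
import Data.List.Relation.Unary.Any.Properties as AnyP
open import Data.List.Relation.Unary.AllPairs as AllPairs using (AllPairs; []; _∷_)
import Data.List.Relation.Unary.AllPairs.Properties as AllPairsP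
open import Data.Empty using (⊥-elim-irr)
open import Function using (_∘_)
open import Relation.Nullary using (yes; no; contradiction)
open import Relation.Nullary.Decidable using (recompute)
open import Relation.Binary.PropositionalEquality

∣⁅x⁆∪p∣≡1+∣p∣ : ∀ {n} {x : Fin n} (p : Subset n) → x ∉ p → ∣ ⁅ x ⁆ ∪ p ∣ ≡ suc ∣ p ∣
∣⁅x⁆∪p∣≡1+∣p∣ {x = zero}  (inside ∷ p)  x∉p = contradiction here x∉p
∣⁅x⁆∪p∣≡1+∣p∣ {x = zero}  (outside ∷ p) _   = cong (suc ∘ ∣_∣) (∪-identityˡ p)
∣⁅x⁆∪p∣≡1+∣p∣ {x = suc x} (inside ∷ p)  x∉p = cong suc (∣⁅x⁆∪p∣≡1+∣p∣ p (x∉p ∘ there))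
∣⁅x⁆∪p∣≡1+∣p∣ {x = suc x} (outside ∷ p) x∉p = ∣⁅x⁆∪p∣≡1+∣p∣ p (x∉p ∘ there)

⊆∧∣⊇∣⇒≡ : ∀ {n} {p q : Subset n} → p ⊆ q → ∣ q ∣ ≤ ∣ p ∣ → p ≡ q
⊆∧∣⊇∣⇒≡ {p = []}          {[]}          _   _ = refl
⊆∧∣⊇∣⇒≡ {p = inside ∷ p}  {inside ∷ q}  p⊆q ∣q∣≤∣p∣ =
  cong (inside ∷_) (⊆∧∣⊇∣⇒≡ (drop-∷-⊆ p⊆q) (≤-pred ∣q∣≤∣p∣))
⊆∧∣⊇∣⇒≡ {p = outside ∷ p} {outside ∷ q} p⊆q ∣q∣≤∣p∣ =
  cong (outside ∷_) (⊆∧∣⊇∣⇒≡ (drop-∷-⊆ p⊆q) ∣q∣≤∣p∣)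
⊆∧∣⊇∣⇒≡ {p = inside ∷ p}  {outside ∷ q} p⊆q _ with p⊆q here
... | ()
⊆∧∣⊇∣⇒≡ {p = outside ∷ p} {inside ∷ q}  p⊆q 1+∣q∣≤∣p∣ =
  contradiction (≤-trans 1+∣q∣≤∣p∣ (p⊆q⇒∣p∣≤∣q∣ (drop-∷-⊆ p⊆q))) (<-irrefl refl)

∣p∣<n⇒∃∉ : ∀ {n} (p : Subset n) → ∣ p ∣ < n → ∃ λ i → i ∉ p
∣p∣<n⇒∃∉ {n} p ∣p∣<n = ¬∀⟶∃¬ n (_∈ p) (_∈? p) λ all∈p →
  <⇒≱ ∣p∣<n (subst (_≤ ∣ p ∣) (∣⊤∣≡n n) (p⊆q⇒∣p∣≤∣q∣ {p = ⊤} (λ {i} _ → all∈p i)))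

toSubset : ∀ {n} → List (Fin n) → Subset n
toSubset = foldr (λ i s → ⁅ i ⁆ ∪ s) ⊥

toSubset⁺ : ∀ {n} {i : Fin n} (is : List (Fin n)) → i ∈ˡ is → i ∈ toSubset is
toSubset⁺ (j ∷ is) (here refl)  = x∈p∪q⁺ (inj₁ (x∈⁅x⁆ j))
toSubset⁺ (j ∷ is) (there i∈is) = x∈p∪q⁺ (inj₂ (toSubset⁺ is i∈is))

toSubset⁻ : ∀ {n} {i : Fin n} (is : List (Fin n)) → i ∈ toSubset is → i ∈ˡ is
toSubset⁻ []       i∈ = contradiction i∈ ∉⊥
toSubset⁻ (j ∷ is) i∈ with x∈p∪q⁻ ⁅ j ⁆ (toSubset is) i∈
... | inj₁ i∈⁅j⁆ = here (x∈⁅y⁆⇒x≡y j i∈⁅j⁆)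
... | inj₂ i∈s   = there (toSubset⁻ is i∈s)

toSubset-⊆ : ∀ {n} {S : Subset n} {is : List (Fin n)} → All (_∈ S) is → toSubset is ⊆ S
toSubset-⊆ {is = is} all∈S i∈ = All.lookup all∈S (toSubset⁻ is i∈)

∣toSubset∣≡length : ∀ {n} {is : List (Fin n)} → AllPairs _≢_ is → ∣ toSubset is ∣ ≡ length is
∣toSubset∣≡length {n} {is = []} [] = ∣⊥∣≡0 n
∣toSubset∣≡length {is = i ∷ is} (i∉is ∷ distinct) =
  trans (∣⁅x⁆∪p∣≡1+∣p∣ (toSubset is) (λ i∈ → All.lookup i∉is (toSubset⁻ is i∈) refl))
        (cong suc (∣toSubset∣≡length distinct))

module _ {k q m : ℕ} where

  partSet : List (Vertex k q m) → Subset q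
  partSet xs = toSubset (map part xs)

  -- Adjacent vertices lie in different parts, so a clique meets as many
  -- parts as it has vertices.
  ∣partSet∣≡length : ∀ {xs} → IsClique xs → ∣ partSet xs ∣ ≡ length xs
  ∣partSet∣≡length {xs} cl =
    trans (∣toSubset∣≡length (AllPairsP.map⁺ (AllPairs.map proj₁ cl))) (length-map part xs)

  clique-length≤ : ∀ {xs S} → IsClique xs → All (λ v → part v ∈ S) xs → length xs ≤ ∣ S ∣
  clique-length≤ cl all∈S =
    subst (_≤ _) (∣partSet∣≡length cl) (p⊆q⇒∣p∣≤∣q∣ (toSubset-⊆ (AllP.map⁺ all∈S)))

  parts∈partSet : (xs : List (Vertex k q m)) → All (λ v → part v ∈ partSet xs) xs
  parts∈partSet xs = AllP.map⁻ (All.tabulate (toSubset⁺ (map part xs)))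

  colouring-cong : (g : Colouring k q m) {S T : Subset q} → S ≡ T →
                   .(p : ∣ S ∣ ≡ k) .(p′ : ∣ T ∣ ≡ k) → g S p ≡ g T p′
  colouring-cong g refl _ _ = refl

  extend : Fin m → List (Vertex k q m) → Colouring k q m
  extend d []       S p = d
  extend d (v ∷ xs) S p with part v ∈? S
  ... | yes _   = extend d xs S p
  ... | no v∉S  = fun v S p v∉S

  extend-head : ∀ d v xs → InC (extend d (v ∷ xs)) v
  extend-head d v xs S p v∉S with part v ∈? S
  ... | yes v∈S = ⊥-elim-irr (v∉S v∈S)
  ... | no _    = refl

  extend-cons : ∀ d v xs w → Adjacent v w → InC (extend d xs) w → InC (extend d (v ∷ xs)) w
  extend-cons d v xs w v~w w∈C S p w∉S with part v ∈? S
  ... | yes _   = w∈C S p w∉S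
  ... | no v∉S  = sym (proj₂ v~w S p v∉S w∉S)

  extend-contains : ∀ d xs → IsClique xs → ContainedInC xs (extend d xs)
  extend-contains d []       []          = []
  extend-contains d (v ∷ xs) (v~xs ∷ cl) = extend-head d v xs ∷
    All.zipWith (λ (v~w , w∈C) → extend-cons d v xs _ v~w w∈C) (v~xs , extend-contains d xs cl)

  extend-agrees : ∀ d xs (g : Colouring k q m) → ContainedInC xs g → ∀ S .(p : ∣ S ∣ ≡ k) →
                  All (λ v → part v ∈ S) xs ⊎ extend d xs S p ≡ g S p
  extend-agrees d []       g []            S p = inj₁ []
  extend-agrees d (v ∷ xs) g (v∈Cg ∷ xs⊆Cg) S p with part v ∈? S
  ... | no v∉S = inj₂ (v∈Cg S p v∉S)
  ... | yes v∈S with extend-agrees d xs g xs⊆Cg S p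
  ...   | inj₁ all∈S = inj₁ (v∈S ∷ all∈S)
  ...   | inj₂ agree = inj₂ agree

  extend-default : ∀ d xs S .(p : ∣ S ∣ ≡ k) → All (λ v → part v ∈ S) xs → extend d xs S p ≡ d
  extend-default d []       S p []            = refl
  extend-default d (v ∷ xs) S p (v∈S ∷ all∈S) with part v ∈? S
  ... | yes _  = extend-default d xs S p all∈S
  ... | no v∉S = contradiction v∈S v∉S

  restrict : Colouring k q m → Fin q → Vertex k q m
  restrict f i = vtx i (λ S p _ → f S p)

  C : Colouring k q m → List (Vertex k q m)
  C f = tabulate (restrict f)

  C-isClique : ∀ f → IsClique (C f)
  C-isClique f = AllPairsP.tabulate⁺ (λ i≢j → i≢j , λ S _ _ _ → refl)

  InC⇒Member : ∀ {f v} → InC f v → Member v (C f)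
  InC⇒Member {v = v} v∈Cf = AnyP.tabulate⁺ (part v) (refl , λ S p v∉S _ → v∈Cf S p v∉S)

  -- A maximal clique contains C_{extend d xs}, so it meets all q parts.
  maximal-length : Fin m → (xs : List (Vertex k q m)) → IsMaximalClique xs → length xs ≡ q
  maximal-length d xs (cl , maximal) = ≤-antisym
      (subst (_≤ q) (∣partSet∣≡length cl) (∣p∣≤n (partSet xs)))
      (subst₂ _≤_ (∣⊤∣≡n q) (∣partSet∣≡length cl) (p⊆q⇒∣p∣≤∣q∣ {p = ⊤} (λ {i} _ → meets i)))
    where
    Cf = C (extend d xs)
    Cf⊆xs : All (λ w → Member w xs) Cf
    Cf⊆xs = maximal Cf (C-isClique _) (All.map InC⇒Member (extend-contains d xs cl))
    meets : ∀ i → i ∈ partSet xs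
    meets i = toSubset⁺ (map part xs) (AnyP.map⁺ (Any.map proj₁ (AllP.tabulate⁻ Cf⊆xs i)))

  -- A clique with k+1 vertices has no k-set containing all its parts, so
  -- every C_g containing it is C_{extend d xs}.
  unique-extension : ∀ d xs → IsClique xs → length xs ≡ suc k →
                     (g : Colouring k q m) → ContainedInC xs g → SameC (extend d xs) g
  unique-extension d xs cl len g xs⊆Cg _ S p _ with extend-agrees d xs g xs⊆Cg S p
  ... | inj₂ agree = agree
  ... | inj₁ all∈S = contradiction
        (subst₂ _≤_ len (recompute (∣ S ∣ ≟ k) p) (clique-length≤ cl all∈S)) (<-irrefl refl)

  -- A clique with k vertices: its parts form a k-set P, the one k-set on
  -- which the colourings containing it are unconstrained.
  module _ (xs : List (Vertex k q m)) (cl : IsClique xs) (len : length xs ≡ k) where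

    ∣partSet∣≡k : ∣ partSet xs ∣ ≡ k
    ∣partSet∣≡k = trans (∣partSet∣≡length cl) len

    -- Distinct default colours give distinct cliques C_{extend j xs}: some part
    -- i ∉ P exists, and the restriction to F_i sees the colour of P.
    extension-injective : k < q → (j j′ : Fin m) → SameC (extend j xs) (extend j′ xs) → j ≡ j′
    extension-injective k<q j j′ same = begin
      j                                     ≡⟨ sym (extend-default j xs P ∣partSet∣≡k (parts∈partSet xs)) ⟩
      extend j xs P ∣partSet∣≡k             ≡⟨ same i P ∣partSet∣≡k i∉P ⟩
      extend j′ xs P ∣partSet∣≡k            ≡⟨ extend-default j′ xs P ∣partSet∣≡k (parts∈partSet xs) ⟩
      j′                                    ∎
      where
      open ≡-Reasoning
      P = partSet xs
      missing = ∣p∣<n⇒∃∉ P (subst (_< q) (sym ∣partSet∣≡k) k<q)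
      i = proj₁ missing
      i∉P = proj₂ missing

    colourOfParts : Colouring k q m → Fin m
    colourOfParts g = g (partSet xs) ∣partSet∣≡k

    -- Every C_g containing xs is C_{extend c xs} for the colour c = g(P): the
    -- only k-set containing all parts of xs is P itself.
    extension-complete : (g : Colouring k q m) → ContainedInC xs g →
                         SameC g (extend (colourOfParts g) xs)
    extension-complete g xs⊆Cg _ S p _ with extend-agrees (colourOfParts g) xs g xs⊆Cg S p
    ... | inj₂ agree = sym agree
    ... | inj₁ all∈S = begin
      g S p                          ≡⟨ colouring-cong g (sym P≡S) p ∣partSet∣≡k ⟩
      colourOfParts g                ≡⟨ sym (extend-default _ xs S p all∈S) ⟩
      extend (colourOfParts g) xs S p ∎
      where
      open ≡-Reasoning
      P≡S : partSet xs ≡ S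
      P≡S = ⊆∧∣⊇∣⇒≡ (toSubset-⊆ (AllP.map⁺ all∈S))
                     (≤-reflexive (trans (recompute (∣ S ∣ ≟ k) p) (sym ∣partSet∣≡k)))

lemma2p2 : (k q m : ℕ) → 1 ≤ k → k < q → 1 ≤ m →
      ((xs : List (Vertex k q m)) → IsClique xs →
         Σ (Colouring k q m) (λ f → ContainedInC xs f))
    × ((xs : List (Vertex k q m)) → IsMaximalClique xs → length xs ≡ q)
    × ((xs : List (Vertex k q m)) → IsClique xs → length xs ≡ suc k →
         Σ (Colouring k q m) (λ f → ContainedInC xs f ×
           ((g : Colouring k q m) → ContainedInC xs g → SameC f g)))
    × ((xs : List (Vertex k q m)) → IsClique xs → length xs ≡ k →
         Σ (Fin m → Colouring k q m) (λ fs →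
           ((j : Fin m) → ContainedInC xs (fs j))
           × ((j j′ : Fin m) → SameC (fs j) (fs j′) → j ≡ j′)
           × ((g : Colouring k q m) → ContainedInC xs g → ∃ (λ j → SameC g (fs j)))))
lemma2p2 k q zero    _ _   ()
lemma2p2 k q (suc m) _ k<q _ =
    (λ xs cl → extend zero xs , extend-contains zero xs cl)
  , maximal-length zero
  , (λ xs cl len → extend zero xs , extend-contains zero xs cl , unique-extension zero xs cl len)
  , (λ xs cl len → (λ j → extend j xs)
                 , (λ j → extend-contains j xs cl)
                 , extension-injective xs cl len k<q
                 , λ g xs⊆Cg → _ , extension-complete xs cl len g xs⊆Cg)
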